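{- For every graph $H$ with at least one edge there are positive constants $c_H$ and $c'_H$ such that, for every positive integer $n$: (i) $S(H,n,b) \leq c_H \cdot n^{v(H)} (b+1)^{ -e(H)}$ for every integer $b \geq 1$; (ii) if $b \geq c'_H \cdot n^{1/m(H)}$, then $S(H,n,b)=0$.
   Context: A biased $(b:1)$ Waiter-Client game $(X,\mathcal F)$ (with $X$ a finite set, $\mathcal F$ a family of subsets of $X$, $b$ a positive integer) is played in rounds: in each round Waiter selects exactly $b+1$ elements of $X$ not previously selected and offers them to Client; Client keeps one of them and the other $b$ go to Waiter. If at some point at most $b$ free elements remain, they all go to Waiter. The value of the game is the number of sets $A\in\mathcal F$ all of whose elements were claimed by Client at the end, assuming optimal play (Waiter maximizes, Client minimizes). For a graph $H$, $S(H,n,b)$ denotes the value of the $(b:1)$ Waiter-Client game whose board is the edge set of $K_n$ and whose winning sets are the edge sets of all copies of $H$ in $K_n$. $v(G)$, $e(G)$ denote the number of vertices and edges of $G$, and $m(H)=\max\{e(H')/v(H') : H'\subseteq H, v(H')\geq 1\}$. -}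

module Defs where

open import Data.Nat using (ℕ; zero; suc; _⊔_; _⊓_; _≤ᵇ_; _<ᵇ_)
open import Data.Bool using (Bool; true; false; _∧_; _∨_; not)
open import Data.Fin using (Fin; toℕ)
import Data.Fin as Fin
open import Data.Vec using (Vec; []; _∷_; lookup)
open import Data.List using (List; []; _∷_; [_]; map; _++_; length; filterᵇ; deduplicate; allFin; cartesianProduct; concatMap; zip; foldr)
open import Data.List.Properties using (≡-dec)
open import Data.Bool.ListAction using (all; any)
open import Data.Product.Properties using () renaming (≡-dec to ×-≡-dec)
import Data.Bool as B
open import Data.Product using (_×_; _,_; proj₁; proj₂)
open import Relation.Binary.PropositionalEquality using (_≡_)
open import Relation.Binary.Definitions using (DecidableEquality)
open import Relation.Nullary.Decidable using (does)
open import Data.Integer using (+_)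
open import Data.Rational using (ℚ; 0ℚ; _/_)
import Data.Rational as Q

-- Generic (b:1) Waiter-Client game on a finite board (list without
-- repetitions) with a family F of winning sets (list of lists).

choose : {X : Set} → ℕ → List X → List (List X × List X)
choose zero xs = [ ([] , xs) ]
choose (suc k) [] = []
choose (suc k) (x ∷ xs) =
  map (λ p → (x ∷ proj₁ p , proj₂ p)) (choose k xs)
  ++ map (λ p → (proj₁ p , x ∷ proj₂ p)) (choose (suc k) xs)

maxL : List ℕ → ℕ
maxL = foldr _⊔_ 0

minL : List ℕ → ℕ
minL [] = 0
minL (x ∷ []) = x
minL (x ∷ y ∷ ys) = x ⊓ minL (y ∷ ys)

module WaiterClient {X : Set} (_≟_ : DecidableEquality X)
                    (F : List (List X)) (b : ℕ) where

  score : List X → ℕ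
  score C = length (filterᵇ (λ A → all (λ a → any (λ c → does (a ≟ c)) C) A) F)

  -- value of the game from a position with free elements `free` and
  -- Client's elements C (fuel argument only ensures termination;
  -- it is never exhausted when started with the length of the board).
  -- Waiter maximises over offers of b+1 free elements, Client minimises
  -- over the offered element he keeps; if at most b free elements
  -- remain, they go to Waiter and the game ends.
  val : ℕ → List X → List X → ℕ
  val zero free C = score C
  val (suc f) free C with length free ≤ᵇ b
  ... | true = score C
  ... | false = maxL (map (λ p → minL (map (λ e → val f (proj₂ p) (e ∷ C)) (proj₁ p)))
                          (choose (suc b) free))

WCValue : {X : Set} → DecidableEquality X → (board : List X) → List (List X) → ℕ → ℕ
WCValue _≟_ board F b = WaiterClient.val _≟_ F b (length board) board []

record Graph : Set where
  field
    k      : ℕ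
    adj    : Fin k → Fin k → Bool
    sym    : ∀ i j → adj i j ≡ adj j i
    irrefl : ∀ i → adj i i ≡ false

_=ᶠ_ : {n : ℕ} → Fin n → Fin n → Bool
i =ᶠ j = does (i Fin.≟ j)

orderedPairs : (n : ℕ) → List (Fin n × Fin n)
orderedPairs n = filterᵇ (λ p → toℕ (proj₁ p) <ᵇ toℕ (proj₂ p))
                         (cartesianProduct (allFin n) (allFin n))

edges : (H : Graph) → List (Fin (Graph.k H) × Fin (Graph.k H))
edges H = filterᵇ (λ p → Graph.adj H (proj₁ p) (proj₂ p)) (orderedPairs (Graph.k H))

v : Graph → ℕ
v H = Graph.k H

e : Graph → ℕ
e H = length (edges H)

KnEdges : (n : ℕ) → List (Fin n × Fin n)
KnEdges = orderedPairs

pairEq : {n : ℕ} → DecidableEquality (Fin n × Fin n)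
pairEq = ×-≡-dec Fin._≟_ Fin._≟_

allVecs : {A : Set} → List A → (k : ℕ) → List (Vec A k)
allVecs as zero = [ [] ]
allVecs as (suc k) = concatMap (λ x → map (x ∷_) (allVecs as k)) as

injectiveᵇ : {k n : ℕ} → Vec (Fin n) k → Bool
injectiveᵇ {k} φ = all (λ i → all (λ j → (i =ᶠ j) ∨ not (lookup φ i =ᶠ lookup φ j))
                              (allFin k)) (allFin k)

-- characteristic vector (over KnEdges n) of the edge set of the image of H
-- under the vertex map φ
imageChar : (H : Graph) (n : ℕ) → Vec (Fin n) (Graph.k H) → List Bool
imageChar H n φ =
  map (λ xy → any (λ ij → Graph.adj H (proj₁ ij) (proj₂ ij)
                          ∧ (lookup φ (proj₁ ij) =ᶠ proj₁ xy)
                          ∧ (lookup φ (proj₂ ij) =ᶠ proj₂ xy))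
                  (cartesianProduct (allFin (Graph.k H)) (allFin (Graph.k H))))
      (KnEdges n)

fromChar : {n : ℕ} → List Bool → List (Fin n × Fin n)
fromChar {n} bs = map proj₁ (filterᵇ proj₂ (zip (KnEdges n) bs))

-- the family of edge sets of all copies of H in K_n (each edge set once)
copies : (H : Graph) (n : ℕ) → List (List (Fin n × Fin n))
copies H n = map fromChar
  (deduplicate (≡-dec B._≟_)
    (map (imageChar H n) (filterᵇ injectiveᵇ (allVecs (allFin n) (Graph.k H)))))

S : Graph → ℕ → ℕ → ℕ
S H n b = WCValue pairEq (KnEdges n) (copies H n) b

-- maximum density m(H) = max { e(H')/v(H') : H' ⊆ H, v(H') ≥ 1 }

sublists : {A : Set} → List A → List (List A)
sublists [] = [ [] ]
sublists (x ∷ xs) = map (x ∷_) (sublists xs) ++ sublists xs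

count : List Bool → ℕ
count bs = length (filterᵇ (λ x → x) bs)

density : ℕ → ℕ → ℚ
density e' zero = 0ℚ
density e' (suc v') = (+ e') / suc v'

-- all subgraphs H' = (vertex subset V', edge subset E' with endpoints in V'),
-- with v(H') ≥ 1, recorded by their densities
subgraphDensities : Graph → List ℚ
subgraphDensities H =
  concatMap (λ V' → map (λ E' → density (length E') (count (Data.Vec.toList V')))
                        (sublists (filterᵇ (λ ij → lookup V' (proj₁ ij) ∧ lookup V' (proj₂ ij))
                                           (edges H))))
            (filterᵇ (λ V' → 1 ≤ᵇ count (Data.Vec.toList V'))
                     (allVecs (true ∷ false ∷ []) (Graph.k H)))
  where import Data.Vec

m : Graph → ℚ
m H = foldr Q._⊔_ 0ℚ (subgraphDensities H)

module Submission where

-- Client plays the Waiter-Client version of the Erdős–Selfridge potential strategy.  Fix a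
-- family G of "witness" edge sets and give each A ∈ G the weight (b+1)^|A ∩ C| (C = Client's
-- edges) as long as Waiter owns no edge of A.  When Waiter offers b+1 edges, the weights of A
-- summed over Client's b+1 possible answers are at most (b+1) times the current weight of A,
-- so some answer does not increase the total potential.  The potential starts at |G|, and at
-- the end every fully claimed A contributes (b+1)^|A|.
--   (i)  With G the images of H under injective vertex maps (at most n^v(H) of them), every
--        copy of H that Client claims contributes (b+1)^e(H), so S(H,n,b) (b+1)^e(H) ≤ n^v(H).
--   (ii) With G the images of a densest subgraph H′ under maps varying only on V(H′), the
--        potential stays ≤ n^v(H′) < (b+1)^e(H′) once b ≥ n^(1/m(H)), which is too little to
--        pay for a single claimed copy of H.

open import Data.Bool using (Bool; true; false; _∧_; _∨_; T; if_then_else_)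
import Data.Bool as Bool
open import Data.Bool.ListAction using (all; any)
open import Data.Bool.Properties using (T-≡; ∨-zeroʳ)
open import Data.Empty using (⊥-elim)
open import Data.Fin using (Fin; toℕ) renaming (zero to fzero; suc to fsuc)
import Data.Fin as Fin
import Data.Fin.Properties as Finₚ
open import Data.Integer using (∣_∣) renaming (+_ to +ℤ_)
import Data.Integer.GCD as ℤ
import Data.Integer.Properties as ℤₚ
open import Data.List
  using (List; []; _∷_; foldr; map; length; filterᵇ; deduplicate; zip; allFin; cartesianProduct;
         concatMap)
open import Data.List.Properties
  using (length-++; length-map; length-tabulate; length-filter; ≡-dec; map-cong-local)
import Data.List.Membership.DecPropositional as DecMembership
open import Data.List.Membership.Propositional using (_∈_; _∉_; find; lose)
open import Data.List.Membership.Propositional.Properties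
  using (∈-filter⁻; ∈-filter⁺; ∈-++⁻; ∈-map⁺; ∈-map⁻; ∈-concatMap⁺; ∈-concatMap⁻;
         ∈-cartesianProduct⁺; ∈-allFin; ∈-deduplicate⁻)
open import Data.List.Relation.Binary.Sublist.Propositional using (_⊆_; []; _∷_; _∷ʳ_; ⊆-trans)
open import Data.List.Relation.Binary.Sublist.Propositional.Properties
  using (All-resp-⊆; Any-resp-⊆; filter-⊆; filter⁺; length-mono-≤)
open import Data.List.Relation.Unary.All using (All; []; _∷_)
import Data.List.Relation.Unary.All as All
open import Data.List.Relation.Unary.All.Properties using (¬Any⇒All¬; All¬⇒¬Any)
import Data.List.Relation.Unary.All.Properties as Allₚ
open import Data.List.Relation.Unary.Any using (here; there; any?)
open import Data.List.Relation.Unary.Unique.Propositional using (Unique; []; _∷_)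
import Data.List.Relation.Unary.Unique.Propositional.Properties as Uniqueₚ
open import Data.Nat
  using (ℕ; zero; suc; _+_; _*_; _^_; _≤_; _<_; _⊔_; z≤n; s≤s; _≤?_; _≤ᵇ_; _<ᵇ_; _≟_; >-nonZero)
open import Data.Nat.Properties
open import Algebra.Properties.CommutativeSemigroup +-commutativeSemigroup
  using (interchange; x∙yz≈y∙xz; x∙yz≈yx∙z)
open import Data.Product using (Σ; _×_; _,_; proj₁; proj₂; ∃; map₂)
open import Data.Rational using (ℚ; 0ℚ; ↥_; ↧_; ↧ₙ_)
import Data.Rational as ℚ
import Data.Rational.Properties as ℚₚ
open import Data.Sum using (_⊎_; inj₁; inj₂; [_,_])
open import Data.Vec using (Vec; []; _∷_; lookup)
import Data.Vec as Vec
import Data.Vec.Properties as Vecₚ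
open import Defs
open import Function using (_∘_; id; Equivalence; case_of_)
open import Relation.Binary.Definitions using (DecidableEquality)
open import Relation.Binary.PropositionalEquality hiding ([_])
open import Relation.Nullary using (yes; no; ¬_; contradiction)
open import Relation.Nullary.Decidable using (does; T?; dec-true)

private
  variable
    A B : Set
    x : A
    xs ys : List A
    f g : A → ℕ

∑ : (A → ℕ) → List A → ℕ
∑ f [] = 0
∑ f (x ∷ xs) = f x + ∑ f xs

∑-mono-≤ : (xs : List A) → (∀ {x} → x ∈ xs → f x ≤ g x) → ∑ f xs ≤ ∑ g xs
∑-mono-≤ [] f≤g = z≤n
∑-mono-≤ (x ∷ xs) f≤g = +-mono-≤ (f≤g (here refl)) (∑-mono-≤ xs (f≤g ∘ there))

∑-cong : (xs : List A) → (∀ {x} → x ∈ xs → f x ≡ g x) → ∑ f xs ≡ ∑ g xs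
∑-cong [] f≡g = refl
∑-cong (x ∷ xs) f≡g = cong₂ _+_ (f≡g (here refl)) (∑-cong xs (f≡g ∘ there))

∑-zero : (xs : List A) → (∀ {x} → x ∈ xs → f x ≡ 0) → ∑ f xs ≡ 0
∑-zero [] f≡0 = refl
∑-zero (x ∷ xs) f≡0 = cong₂ _+_ (f≡0 (here refl)) (∑-zero xs (f≡0 ∘ there))

∑-const : (c : ℕ) (xs : List A) → ∑ (λ _ → c) xs ≡ length xs * c
∑-const c [] = refl
∑-const c (x ∷ xs) = cong (c +_) (∑-const c xs)

∑-*ˡ : (c : ℕ) (f : A → ℕ) (xs : List A) → ∑ (λ x → c * f x) xs ≡ c * ∑ f xs
∑-*ˡ c f [] = sym (*-zeroʳ c)
∑-*ˡ c f (x ∷ xs) =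
  trans (cong (c * f x +_) (∑-*ˡ c f xs)) (sym (*-distribˡ-+ c (f x) (∑ f xs)))

∑-+ : (f g : A → ℕ) (xs : List A) → ∑ (λ x → f x + g x) xs ≡ ∑ f xs + ∑ g xs
∑-+ f g [] = refl
∑-+ f g (x ∷ xs) =
  trans (cong (f x + g x +_) (∑-+ f g xs)) (interchange (f x) (g x) (∑ f xs) (∑ g xs))

∑-comm : (h : A → B → ℕ) (xs : List A) (ys : List B) →
         ∑ (λ x → ∑ (h x) ys) xs ≡ ∑ (λ y → ∑ (λ x → h x y) xs) ys
∑-comm h [] ys = sym (trans (∑-const 0 ys) (*-zeroʳ (length ys)))
∑-comm h (x ∷ xs) ys = trans (cong (∑ (h x) ys +_) (∑-comm h xs ys))
                             (sym (∑-+ (h x) (λ y → ∑ (λ x → h x y) xs) ys))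

∑-map : (f : B → ℕ) (g : A → B) (xs : List A) → ∑ f (map g xs) ≡ ∑ (f ∘ g) xs
∑-map f g [] = refl
∑-map f g (x ∷ xs) = cong (f (g x) +_) (∑-map f g xs)

∈⇒≤∑ : (f : A → ℕ) → x ∈ xs → f x ≤ ∑ f xs
∈⇒≤∑ f (here refl) = m≤m+n _ _
∈⇒≤∑ f (there x∈) = ≤-trans (∈⇒≤∑ f x∈) (m≤n+m _ _)

∑-pigeonhole : (f : A → ℕ) (M : ℕ) (xs : List A) →
               1 ≤ length xs → ∑ f xs ≤ length xs * M → ∃ λ x → x ∈ xs × f x ≤ M
∑-pigeonhole f M (x ∷ xs) _ ∑≤ with f x ≤? M
... | yes fx≤M = x , here refl , fx≤M
∑-pigeonhole f M (x ∷ []) _ ∑≤ | no fx≰M =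
  ⊥-elim (fx≰M (subst₂ _≤_ (+-identityʳ (f x)) (*-identityˡ M) ∑≤))
∑-pigeonhole f M (x ∷ y ∷ xs) _ ∑≤ | no fx≰M =
  let z , z∈ , fz≤M = ∑-pigeonhole f M (y ∷ xs) (s≤s z≤n)
                        (+-cancelˡ-≤ M _ _ (≤-trans (+-monoˡ-≤ _ (<⇒≤ (≰⇒> fx≰M))) ∑≤))
  in z , there z∈ , fz≤M

1≤length⇒∈ : 1 ≤ length xs → ∃ λ x → x ∈ xs
1≤length⇒∈ {xs = x ∷ _} _ = x , here refl

minL-≤ : (h : A → ℕ) → x ∈ xs → minL (map h xs) ≤ h x
minL-≤ {xs = x ∷ []} h (here refl) = ≤-refl
minL-≤ {xs = x ∷ y ∷ ys} h (here refl) = m⊓n≤m (h x) _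
minL-≤ {xs = x ∷ y ∷ ys} h (there x∈) = ≤-trans (m⊓n≤n (h x) _) (minL-≤ h x∈)

maxL-closed : (Q : ℕ → Set) → (∀ {m n} → Q m → Q n → Q (m ⊔ n)) → Q 0 →
              (g : A → ℕ) (xs : List A) → (∀ {x} → x ∈ xs → Q (g x)) →
              Q (maxL (map g xs))
maxL-closed Q Q-⊔ Q0 g [] Qg = Q0
maxL-closed Q Q-⊔ Q0 g (x ∷ xs) Qg =
  Q-⊔ (Qg (here refl)) (maxL-closed Q Q-⊔ Q0 g xs (Qg ∘ there))

all-true⁺ : (p : A → Bool) (xs : List A) →
            (∀ {x} → x ∈ xs → p x ≡ true) → all p xs ≡ true
all-true⁺ p [] px = refl
all-true⁺ p (x ∷ xs) px rewrite px (here refl) = all-true⁺ p xs (px ∘ there)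

all-true⁻ : (p : A → Bool) (xs : List A) → all p xs ≡ true → x ∈ xs → p x ≡ true
all-true⁻ p (y ∷ ys) all≡ x∈ with p y in py
all-true⁻ p (y ∷ ys) all≡ (here refl) | true = py
all-true⁻ p (y ∷ ys) all≡ (there x∈) | true = all-true⁻ p ys all≡ x∈

any-true⁺ : (p : A → Bool) → x ∈ xs → p x ≡ true → any p xs ≡ true
any-true⁺ p (here refl) px rewrite px = refl
any-true⁺ {xs = y ∷ ys} p (there x∈) px with p y
... | true = refl
... | false = any-true⁺ p x∈ px

∧-true⁻ : ∀ {p q} → p ∧ q ≡ true → p ≡ true × q ≡ true
∧-true⁻ {true} {true} _ = refl , refl

∈-filterᵇ⁻ : (p : A → Bool) (xs : List A) → x ∈ filterᵇ p xs → x ∈ xs × p x ≡ true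
∈-filterᵇ⁻ p xs x∈ = map₂ (Equivalence.to T-≡) (∈-filter⁻ (T? ∘ p) x∈)

length-filterᵇ-map : (p : B → Bool) (f : A → B) (xs : List A) →
                     length (filterᵇ p (map f xs)) ≡ length (filterᵇ (p ∘ f) xs)
length-filterᵇ-map p f [] = refl
length-filterᵇ-map p f (x ∷ xs) with p (f x)
... | true = cong suc (length-filterᵇ-map p f xs)
... | false = length-filterᵇ-map p f xs

length-filterᵇ*≤∑ : (p : A → Bool) (w : A → ℕ) (K : ℕ) (xs : List A) →
                    (∀ {x} → x ∈ xs → p x ≡ true → K ≤ w x) →
                    length (filterᵇ p xs) * K ≤ ∑ w xs
length-filterᵇ*≤∑ p w K [] K≤w = z≤n
length-filterᵇ*≤∑ p w K (x ∷ xs) K≤w with p x in px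
... | true = +-mono-≤ (K≤w (here refl) px) (length-filterᵇ*≤∑ p w K xs (K≤w ∘ there))
... | false = ≤-trans (length-filterᵇ*≤∑ p w K xs (K≤w ∘ there)) (m≤n+m _ _)

deduplicate-⊆ : (_≟_ : DecidableEquality A) (xs : List A) → deduplicate _≟_ xs ⊆ xs
deduplicate-⊆ _≟_ [] = []
deduplicate-⊆ _≟_ (x ∷ xs) = refl ∷ ⊆-trans (filter-⊆ _ _) (deduplicate-⊆ _≟_ xs)

∈-sublists⇒⊆ : xs ∈ sublists ys → xs ⊆ ys
∈-sublists⇒⊆ {ys = []} (here refl) = []
∈-sublists⇒⊆ {ys = y ∷ ys} xs∈ with ∈-++⁻ (map (y ∷_) (sublists ys)) xs∈
... | inj₂ xs∈ʳ = y ∷ʳ ∈-sublists⇒⊆ xs∈ʳ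
... | inj₁ xs∈ˡ with ∈-map⁻ (y ∷_) xs∈ˡ
...   | zs , zs∈ , refl = refl ∷ ∈-sublists⇒⊆ zs∈

Unique-resp-⊇ : xs ⊆ ys → Unique ys → Unique xs
Unique-resp-⊇ [] [] = []
Unique-resp-⊇ (y ∷ʳ τ) (_ ∷ u) = Unique-resp-⊇ τ u
Unique-resp-⊇ (refl ∷ τ) (y∉ ∷ u) = All-resp-⊆ τ y∉ ∷ Unique-resp-⊇ τ u

choose-length : (k : ℕ) (xs : List A) {P R : List A} → (P , R) ∈ choose k xs → length P ≡ k
choose-length zero xs (here refl) = refl
choose-length (suc k) (x ∷ xs) PR∈
  with ∈-++⁻ (map (λ p → x ∷ proj₁ p , proj₂ p) (choose k xs)) PR∈
... | inj₁ PR∈ˡ with ∈-map⁻ _ PR∈ˡ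
...   | _ , PR∈′ , refl = cong suc (choose-length k xs PR∈′)
choose-length (suc k) (x ∷ xs) PR∈ | inj₂ PR∈ʳ with ∈-map⁻ _ PR∈ʳ
...   | _ , PR∈′ , refl = choose-length (suc k) xs PR∈′

boolToℕ : Bool → ℕ
boolToℕ true = 1
boolToℕ false = 0

module Multiplicity {X : Set} (_≟_ : DecidableEquality X) where

  mem : X → List X → Bool
  mem a xs = any (λ c → does (a ≟ c)) xs

  mem⇒∈ : ∀ {a} xs → mem a xs ≡ true → a ∈ xs
  mem⇒∈ {a} (x ∷ xs) mem≡ with a ≟ x
  ... | yes refl = here refl
  ... | no _ = there (mem⇒∈ xs mem≡)

  ∈⇒mem : ∀ {a xs} → a ∈ xs → mem a xs ≡ true
  ∈⇒mem {a} {x ∷ xs} a∈ with a ≟ x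
  ... | yes _ = refl
  ∈⇒mem {a} {x ∷ xs} (here a≡x) | no a≢x = ⊥-elim (a≢x a≡x)
  ∈⇒mem {a} {x ∷ xs} (there a∈) | no _ = ∈⇒mem a∈

  ∉⇒mem≡false : ∀ {a} xs → a ∉ xs → mem a xs ≡ false
  ∉⇒mem≡false {a} xs a∉ with mem a xs in mem≡
  ... | true = ⊥-elim (a∉ (mem⇒∈ xs mem≡))
  ... | false = refl

  occ : X → List X → ℕ
  occ y = ∑ (λ c → boolToℕ (does (y ≟ c)))

  ∈⇒1≤occ : ∀ {y xs} → y ∈ xs → 1 ≤ occ y xs
  ∈⇒1≤occ {y} {x ∷ xs} (here refl) with y ≟ y
  ... | yes _ = s≤s z≤n
  ... | no y≢y = ⊥-elim (y≢y refl)
  ∈⇒1≤occ {y} {x ∷ xs} (there y∈) = ≤-trans (∈⇒1≤occ y∈) (m≤n+m _ _)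

  1≤occ⇒∈ : ∀ {y} xs → 1 ≤ occ y xs → y ∈ xs
  1≤occ⇒∈ {y} (x ∷ xs) 1≤occ with y ≟ x
  ... | yes refl = here refl
  ... | no _ = there (1≤occ⇒∈ xs 1≤occ)

  ≟≤occ : ∀ y {x xs} → x ∈ xs → boolToℕ (does (y ≟ x)) ≤ occ y xs
  ≟≤occ y {x} x∈ with y ≟ x
  ... | yes refl = ∈⇒1≤occ x∈
  ... | no _ = z≤n

  ≢⇒occ≡0 : ∀ {y xs} → All (y ≢_) xs → occ y xs ≡ 0
  ≢⇒occ≡0 [] = refl
  ≢⇒occ≡0 {y} {x ∷ xs} (y≢x ∷ y≢xs) with y ≟ x
  ... | yes y≡x = ⊥-elim (y≢x y≡x)
  ... | no _ = ≢⇒occ≡0 y≢xs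

  ∉⇒occ≡0 : ∀ {y} xs → y ∉ xs → occ y xs ≡ 0
  ∉⇒occ≡0 xs y∉ = ≢⇒occ≡0 (¬Any⇒All¬ xs y∉)

  Unique⇒occ≤1 : ∀ {xs} → Unique xs → ∀ y → occ y xs ≤ 1
  Unique⇒occ≤1 [] y = z≤n
  Unique⇒occ≤1 {x ∷ xs} (x∉ ∷ u) y with y ≟ x
  ... | yes refl = ≤-reflexive (cong suc (≢⇒occ≡0 x∉))
  ... | no _ = Unique⇒occ≤1 u y

  choose-occ : (k : ℕ) (xs : List X) {P R : List X} → (P , R) ∈ choose k xs →
               ∀ y → occ y P + occ y R ≡ occ y xs
  choose-occ zero xs (here refl) y = refl
  choose-occ (suc k) (x ∷ xs) PR∈ y
    with ∈-++⁻ (map (λ p → x ∷ proj₁ p , proj₂ p) (choose k xs)) PR∈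
  ... | inj₁ PR∈ˡ with ∈-map⁻ _ PR∈ˡ
  ...   | (P , R) , PR∈′ , refl =
          trans (+-assoc (boolToℕ (does (y ≟ x))) (occ y P) (occ y R))
                (cong (boolToℕ (does (y ≟ x)) +_) (choose-occ k xs PR∈′ y))
  choose-occ (suc k) (x ∷ xs) PR∈ y | inj₂ PR∈ʳ with ∈-map⁻ _ PR∈ʳ
  ...   | (P , R) , PR∈′ , refl =
          trans (x∙yz≈y∙xz (occ y P) (boolToℕ (does (y ≟ x))) (occ y R))
                (cong (boolToℕ (does (y ≟ x)) +_) (choose-occ (suc k) xs PR∈′ y))

-- The potential of a position in a (b:1) Waiter-Client game

module Weights {X : Set} (_≟_ : DecidableEquality X) (b : ℕ) where
  open Multiplicity _≟_ public

  alive : List X → List X → List X → Bool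
  alive A free C = all (λ a → mem a free ∨ mem a C) A

  alive⁺ : ∀ {A free C} → (∀ {a} → a ∈ A → a ∈ free ⊎ a ∈ C) → alive A free C ≡ true
  alive⁺ {A} {free} {C} ∈free⊎∈C = all-true⁺ _ A λ a∈ → mem-∨ (∈free⊎∈C a∈)
    where
    mem-∨ : ∀ {a} → a ∈ free ⊎ a ∈ C → (mem a free ∨ mem a C) ≡ true
    mem-∨ (inj₁ a∈free) rewrite ∈⇒mem a∈free = refl
    mem-∨ {a} (inj₂ a∈C) rewrite ∈⇒mem a∈C = ∨-zeroʳ (mem a free)

  alive⁻ : ∀ {A free C a} → alive A free C ≡ true → a ∈ A → a ∈ free ⊎ a ∈ C
  alive⁻ {A} {free} {C} {a} al a∈ with mem a free in a∈free | all-true⁻ _ A al a∈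
  ... | true | _ = inj₁ (mem⇒∈ free a∈free)
  ... | false | a∈C = inj₂ (mem⇒∈ C a∈C)

  alive-missing : ∀ {A free C a} → a ∈ A → a ∉ free → a ∉ C → alive A free C ≡ false
  alive-missing {A} {free} {C} a∈ a∉free a∉C with alive A free C in al
  ... | true = ⊥-elim ([ a∉free , a∉C ] (alive⁻ al a∈))
  ... | false = refl

  hits : List X → List X → ℕ
  hits A C = ∑ (λ c → boolToℕ (mem c A)) C

  hits-∷ : ∀ A x C → hits A (x ∷ C) ≤ suc (hits A C)
  hits-∷ A x C with mem x A
  ... | true = ≤-refl
  ... | false = n≤1+n _

  hits-∷-∉ : ∀ {A x} C → x ∉ A → hits A (x ∷ C) ≡ hits A C
  hits-∷-∉ {A} C x∉ rewrite ∉⇒mem≡false A x∉ = refl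

  weight : List X → List X → List X → ℕ
  weight A free C = if alive A free C then suc b ^ hits A C else 0

  weight≤ : ∀ A free C → weight A free C ≤ suc b ^ hits A C
  weight≤ A free C with alive A free C
  ... | true = ≤-refl
  ... | false = z≤n

  claimed : List X → List X → Bool
  claimed A C = all (λ a → mem a C) A

  claimedWeight : List X → List X → ℕ
  claimedWeight A C = if claimed A C then suc b ^ hits A C else 0

  claimedWeight≤weight : ∀ A free C → claimedWeight A C ≤ weight A free C
  claimedWeight≤weight A free C with claimed A C in cl
  ... | false = z≤n
  ... | true rewrite alive⁺ {A} {free} (λ a∈ → inj₂ (mem⇒∈ C (all-true⁻ _ A cl a∈))) = ≤-refl

  ≟+mem≤mem-∷ : ∀ {x B} c → x ∉ B →
                boolToℕ (does (x ≟ c)) + boolToℕ (mem c B) ≤ boolToℕ (mem c (x ∷ B))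
  ≟+mem≤mem-∷ {x} {B} c x∉B with x ≟ c | c ≟ x
  ... | yes refl | yes _ rewrite ∉⇒mem≡false B x∉B = ≤-refl
  ... | yes refl | no c≢c = ⊥-elim (c≢c refl)
  ... | no x≢c | yes c≡x = ⊥-elim (x≢c (sym c≡x))
  ... | no _ | no _ = ≤-refl

  length≤hits : ∀ {B} C → Unique B → claimed B C ≡ true → length B ≤ hits B C
  length≤hits {[]} C [] _ = z≤n
  length≤hits {x ∷ B} C (x≢B ∷ B-unique) cl = begin
    suc (length B)
      ≤⟨ +-mono-≤ (∈⇒1≤occ x∈C) (length≤hits C B-unique B-claimed) ⟩
    occ x C + hits B C
      ≡⟨ sym (∑-+ _ _ C) ⟩
    ∑ (λ c → boolToℕ (does (x ≟ c)) + boolToℕ (mem c B)) C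
      ≤⟨ ∑-mono-≤ C (λ {c} _ → ≟+mem≤mem-∷ c (All¬⇒¬Any x≢B)) ⟩
    hits (x ∷ B) C ∎
    where
    open ≤-Reasoning
    x∈C : x ∈ C
    x∈C = mem⇒∈ C (all-true⁻ _ (x ∷ B) cl (here refl))
    B-claimed : claimed B C ≡ true
    B-claimed = all-true⁺ _ B (all-true⁻ _ (x ∷ B) cl ∘ there)

  claimedWeight-unique : ∀ {B} C → Unique B → claimed B C ≡ true →
                         suc b ^ length B ≤ claimedWeight B C
  claimedWeight-unique C B-unique cl rewrite cl = ^-monoʳ-≤ (suc b) (length≤hits C B-unique cl)

module Potential {X : Set} (_≟_ : DecidableEquality X) (F : List (List X)) (b : ℕ)
                 (G : List (List X)) where
  open WaiterClient _≟_ F b using (val)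
  open WaiterClient _≟_ F b public using (score)
  open Weights _≟_ b
  open DecMembership _≟_ using (_∈?_)

  Distinct : List X → List X → Set
  Distinct free C = ∀ y → occ y free + occ y C ≤ 1

  potential : List X → List X → ℕ
  potential free C = ∑ (λ A → weight A free C) G

  module Offer {free C P R : List X} (dist : Distinct free C)
               (offer : (P , R) ∈ choose (suc b) free) where

    occ-total : ∀ y → occ y P + occ y R + occ y C ≤ 1
    occ-total y = subst (λ o → o + occ y C ≤ 1) (sym (choose-occ (suc b) free offer y)) (dist y)

    ∈P⇒∈free : ∀ {y} → y ∈ P → y ∈ free
    ∈P⇒∈free {y} y∈P = 1≤occ⇒∈ free (≤-trans (∈⇒1≤occ y∈P)
      (≤-trans (m≤m+n _ _) (≤-reflexive (choose-occ (suc b) free offer y))))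

    ∈R⇒∈free : ∀ {y} → y ∈ R → y ∈ free
    ∈R⇒∈free {y} y∈R = 1≤occ⇒∈ free (≤-trans (∈⇒1≤occ y∈R)
      (≤-trans (m≤n+m _ _) (≤-reflexive (choose-occ (suc b) free offer y))))

    ∈free⇒∈P⊎∈R : ∀ {y} → y ∈ free → y ∈ P ⊎ y ∈ R
    ∈free⇒∈P⊎∈R {y} y∈free with y ∈? P
    ... | yes y∈P = inj₁ y∈P
    ... | no y∉P = inj₂ (1≤occ⇒∈ R (subst (1 ≤_) occ-free≡occ-R (∈⇒1≤occ y∈free)))
      where
      occ-free≡occ-R : occ y free ≡ occ y R
      occ-free≡occ-R = trans (sym (choose-occ (suc b) free offer y))
                             (cong (_+ occ y R) (∉⇒occ≡0 P y∉P))

    ∈P⇒∉R : ∀ {y} → y ∈ P → y ∉ R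
    ∈P⇒∉R {y} y∈P y∈R = <-irrefl refl
      (≤-trans (+-mono-≤ (∈⇒1≤occ y∈P) (∈⇒1≤occ y∈R)) (≤-trans (m≤m+n _ _) (occ-total y)))

    ∈P⇒∉C : ∀ {y} → y ∈ P → y ∉ C
    ∈P⇒∉C {y} y∈P y∈C = <-irrefl refl
      (≤-trans (+-mono-≤ (∈⇒1≤occ y∈P) (∈⇒1≤occ y∈C))
               (≤-trans (+-monoˡ-≤ (occ y C) (m≤m+n _ _)) (occ-total y)))

    distinct-next : ∀ {x} → x ∈ P → Distinct R (x ∷ C)
    distinct-next {x} x∈P y = begin
      occ y R + (boolToℕ (does (y ≟ x)) + occ y C)
        ≤⟨ +-monoʳ-≤ (occ y R) (+-monoˡ-≤ (occ y C) (≟≤occ y x∈P)) ⟩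
      occ y R + (occ y P + occ y C)
        ≡⟨ x∙yz≈yx∙z (occ y R) (occ y P) (occ y C) ⟩
      occ y P + occ y R + occ y C
        ≤⟨ occ-total y ⟩
      1 ∎
      where open ≤-Reasoning

    weight-dead : ∀ {A x} → alive A free C ≡ false → x ∈ P → weight A R (x ∷ C) ≡ 0
    weight-dead {A} {x} dead x∈P with alive A R (x ∷ C) in al
    ... | false = refl
    ... | true = contradiction (trans (sym (alive⁺ before)) dead) λ ()
      where
      before : ∀ {a} → a ∈ A → a ∈ free ⊎ a ∈ C
      before a∈ with alive⁻ al a∈
      ... | inj₁ a∈R = inj₁ (∈R⇒∈free a∈R)
      ... | inj₂ (here refl) = inj₁ (∈P⇒∈free x∈P)
      ... | inj₂ (there a∈C) = inj₂ a∈C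

    weight-hit : ∀ {A a x} → a ∈ A → a ∈ P → x ∈ P →
                 weight A R (x ∷ C) ≤ suc b ^ suc (hits A C) * boolToℕ (does (a ≟ x))
    weight-hit {A} {a} {x} a∈A a∈P x∈P with a ≟ x
    ... | yes refl = begin
      weight A R (a ∷ C)         ≤⟨ weight≤ A R (a ∷ C) ⟩
      suc b ^ hits A (a ∷ C)     ≤⟨ ^-monoʳ-≤ (suc b) (hits-∷ A a C) ⟩
      suc b ^ suc (hits A C)     ≡⟨ sym (*-identityʳ _) ⟩
      suc b ^ suc (hits A C) * 1 ∎
      where open ≤-Reasoning
    ... | no a≢x = ≤-reflexive (trans
      (cong (λ al → if al then _ else 0) (alive-missing a∈A (∈P⇒∉R a∈P) a∉x∷C))
      (sym (*-zeroʳ (suc b ^ suc (hits A C)))))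
      where
      a∉x∷C : a ∉ x ∷ C
      a∉x∷C (here a≡x) = a≢x a≡x
      a∉x∷C (there a∈C) = ∈P⇒∉C a∈P a∈C

    weight-miss : ∀ {A x} → alive A free C ≡ true → (∀ {a} → a ∈ A → a ∉ P) → x ∈ P →
                  weight A R (x ∷ C) ≡ suc b ^ hits A C
    weight-miss {A} {x} al A∩P≡∅ x∈P = cong₂ (λ al h → if al then suc b ^ h else 0)
      (alive⁺ {A} after) (hits-∷-∉ C (λ x∈A → A∩P≡∅ x∈A x∈P))
      where
      after : ∀ {a} → a ∈ A → a ∈ R ⊎ a ∈ x ∷ C
      after a∈ with alive⁻ al a∈
      ... | inj₂ a∈C = inj₂ (there a∈C)
      ... | inj₁ a∈free with ∈free⇒∈P⊎∈R a∈free
      ...   | inj₁ a∈P = ⊥-elim (A∩P≡∅ a∈ a∈P)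
      ...   | inj₂ a∈R = inj₁ a∈R

    weight-step : ∀ A → ∑ (λ x → weight A R (x ∷ C)) P ≤ suc b * weight A free C
    weight-step A with alive A free C in al
    ... | false = ≤-reflexive (trans (∑-zero P (weight-dead {A} al)) (sym (*-zeroʳ (suc b))))
    ... | true with any? (_∈? P) A
    ...   | yes A∩P with find A∩P
    ...     | a , a∈A , a∈P = begin
      ∑ (λ x → weight A R (x ∷ C)) P          ≤⟨ ∑-mono-≤ P (weight-hit a∈A a∈P) ⟩
      ∑ (λ x → M * boolToℕ (does (a ≟ x))) P  ≡⟨ ∑-*ˡ M _ P ⟩
      M * occ a P                             ≤⟨ *-monoʳ-≤ M occ-a-P≤1 ⟩
      M * 1                                   ≡⟨ *-identityʳ M ⟩
      suc b * suc b ^ hits A C                ∎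
      where
      open ≤-Reasoning
      M : ℕ
      M = suc b ^ suc (hits A C)
      occ-a-P≤1 : occ a P ≤ 1
      occ-a-P≤1 = ≤-trans (m≤m+n _ _) (≤-trans (m≤m+n _ _) (occ-total a))
    weight-step A | true | no A∩P≢∅ = ≤-reflexive (begin
      ∑ (λ x → weight A R (x ∷ C)) P
        ≡⟨ ∑-cong P (weight-miss {A} al λ a∈A a∈P → A∩P≢∅ (lose a∈A a∈P)) ⟩
      ∑ (λ _ → suc b ^ hits A C) P
        ≡⟨ ∑-const _ P ⟩
      length P * suc b ^ hits A C
        ≡⟨ cong (_* suc b ^ hits A C) (choose-length (suc b) free offer) ⟩
      suc b * suc b ^ hits A C ∎)
      where open ≡-Reasoning

    potential-step : ∃ λ x → x ∈ P × potential R (x ∷ C) ≤ potential free C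
    potential-step = ∑-pigeonhole (λ x → potential R (x ∷ C)) (potential free C) P
                       (subst (1 ≤_) (sym |P|≡1+b) (s≤s z≤n)) averaged
      where
      |P|≡1+b : length P ≡ suc b
      |P|≡1+b = choose-length (suc b) free offer
      averaged : ∑ (λ x → potential R (x ∷ C)) P ≤ length P * potential free C
      averaged = begin
        ∑ (λ x → potential R (x ∷ C)) P
          ≡⟨ ∑-comm (λ x A → weight A R (x ∷ C)) P G ⟩
        ∑ (λ A → ∑ (λ x → weight A R (x ∷ C)) P) G
          ≤⟨ ∑-mono-≤ G (λ {A} _ → weight-step A) ⟩
        ∑ (λ A → suc b * weight A free C) G
          ≡⟨ ∑-*ˡ (suc b) (λ A → weight A free C) G ⟩
        suc b * potential free C
          ≡⟨ cong (_* potential free C) (sym |P|≡1+b) ⟩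
        length P * potential free C ∎
        where open ≤-Reasoning

  -- Client answers every offer as in potential-step; Q has to survive Client's minimum
  -- (downward closure) and Waiter's maximum (closure under ⊔).
  module _ (Q : ℕ → Set) (Q-≤ : ∀ {m n} → m ≤ n → Q n → Q m)
           (Q-⊔ : ∀ {m n} → Q m → Q n → Q (m ⊔ n)) (φ : ℕ)
           (Q-score : ∀ free C → Distinct free C → potential free C ≤ φ → Q (score C)) where

    val-invariant : ∀ f free C → Distinct free C → potential free C ≤ φ → Q (val f free C)
    val-invariant zero free C dist pot = Q-score free C dist pot
    val-invariant (suc f) free C dist pot with length free ≤ᵇ b
    ... | true = Q-score free C dist pot
    ... | false = maxL-closed Q Q-⊔ (Q-≤ z≤n (Q-score free C dist pot)) _ (choose (suc b) free)
      λ { {P , R} offer →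
          let open Offer {free} {C} {P} {R} dist offer
              x , x∈P , pot-next = potential-step
          in Q-≤ (minL-≤ (λ e → val f R (e ∷ C)) x∈P)
                 (val-invariant f R (x ∷ C) (distinct-next x∈P) (≤-trans pot-next pot)) }

  claimedPotential : List X → ℕ
  claimedPotential C = ∑ (λ A → claimedWeight A C) G

  claimedPotential≤potential : ∀ free C → claimedPotential C ≤ potential free C
  claimedPotential≤potential free C = ∑-mono-≤ G (λ {A} _ → claimedWeight≤weight A free C)

  module _ (board : List X) (board-unique : Unique board) where

    distinct-start : Distinct board []
    distinct-start y = subst (_≤ 1) (sym (+-identityʳ _)) (Unique⇒occ≤1 board-unique y)

    potential-start : potential board [] ≤ length G
    potential-start = begin
      potential board []  ≤⟨ ∑-mono-≤ G (λ {A} _ → weight≤ A board []) ⟩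
      ∑ (λ _ → 1) G       ≡⟨ ∑-const 1 G ⟩
      length G * 1        ≡⟨ *-identityʳ _ ⟩
      length G            ∎
      where open ≤-Reasoning

    WCValue-*≤ : (K : ℕ) → (∀ C → score C * K ≤ claimedPotential C) →
                 WCValue _≟_ board F b * K ≤ length G
    WCValue-*≤ K score-bound =
      val-invariant (λ s → s * K ≤ length G) (λ m≤n → ≤-trans (*-monoˡ-≤ K m≤n))
        (λ {m} {n} → ⊔-closed {m} {n}) (length G) final (length board) board [] distinct-start potential-start
      where
      ⊔-closed : ∀ {m n} → m * K ≤ length G → n * K ≤ length G → (m ⊔ n) * K ≤ length G
      ⊔-closed {m} {n} mK≤ nK≤ = subst (_≤ length G) (sym (*-distribʳ-⊔ K m n)) (⊔-lub mK≤ nK≤)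
      final : ∀ free C → Distinct free C → potential free C ≤ length G → score C * K ≤ length G
      final free C _ pot = ≤-trans (score-bound C) (≤-trans (claimedPotential≤potential free C) pot)

    WCValue≡0 : (K : ℕ) → (∀ C → 1 ≤ score C → K ≤ claimedPotential C) → length G < K →
                WCValue _≟_ board F b ≡ 0
    WCValue≡0 K score-bound |G|<K = n≤0⇒n≡0
      (val-invariant (_≤ 0) ≤-trans ⊔-lub (length G) final (length board) board []
         distinct-start potential-start)
      where
      final : ∀ free C → Distinct free C → potential free C ≤ length G → score C ≤ 0
      final free C _ pot with score C in score≡
      ... | zero = z≤n
      ... | suc _ = contradiction
        (≤-trans (score-bound C (subst (1 ≤_) (sym score≡) (s≤s z≤n)))
                 (≤-trans (claimedPotential≤potential free C) pot))
        (<⇒≱ |G|<K)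

-- Copies of H in K_n

Ordered : {n : ℕ} → Fin n × Fin n → Set
Ordered (x , y) = toℕ x < toℕ y

sortPair : {n : ℕ} → Fin n → Fin n → Fin n × Fin n
sortPair x y = if toℕ x <ᵇ toℕ y then (x , y) else (y , x)

sortPair-cases : {n : ℕ} (x y : Fin n) → sortPair x y ≡ (x , y) ⊎ sortPair x y ≡ (y , x)
sortPair-cases x y with toℕ x <ᵇ toℕ y
... | true = inj₁ refl
... | false = inj₂ refl

sortPair-injective : {n : ℕ} {x y x′ y′ : Fin n} → sortPair x y ≡ sortPair x′ y′ →
                     (x ≡ x′ × y ≡ y′) ⊎ (x ≡ y′ × y ≡ x′)
sortPair-injective {x = x} {y} {x′} {y′} eq with toℕ x <ᵇ toℕ y | toℕ x′ <ᵇ toℕ y′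
... | true | true = inj₁ (cong proj₁ eq , cong proj₂ eq)
... | true | false = inj₂ (cong proj₁ eq , cong proj₂ eq)
... | false | true = inj₂ (cong proj₂ eq , cong proj₁ eq)
... | false | false = inj₁ (cong proj₂ eq , cong proj₁ eq)

sortPair-ordered : {n : ℕ} (x y : Fin n) → x ≢ y → Ordered (sortPair x y)
sortPair-ordered x y x≢y with toℕ x <ᵇ toℕ y in x<ᵇy
... | true = <ᵇ⇒< (toℕ x) (toℕ y) (Equivalence.from T-≡ x<ᵇy)
... | false = ≤∧≢⇒< (≮⇒≥ x≮y) (x≢y ∘ sym ∘ Finₚ.toℕ-injective)
  where
  x≮y : ¬ toℕ x < toℕ y
  x≮y x<y = subst T x<ᵇy (<⇒<ᵇ x<y)

orderedPairs-unique : (n : ℕ) → Unique (orderedPairs n)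
orderedPairs-unique n =
  Uniqueₚ.filter⁺ _ (Uniqueₚ.cartesianProduct⁺ (Uniqueₚ.allFin⁺ n) (Uniqueₚ.allFin⁺ n))

∈-orderedPairs⁺ : {n : ℕ} {xy : Fin n × Fin n} → Ordered xy → xy ∈ orderedPairs n
∈-orderedPairs⁺ {xy = x , y} x<y =
  ∈-filter⁺ _ (∈-cartesianProduct⁺ (∈-allFin x) (∈-allFin y)) (<⇒<ᵇ x<y)

∈-selected : (g : A → Bool) {L : List A} → x ∈ L → g x ≡ true →
             x ∈ map proj₁ (filterᵇ proj₂ (zip L (map g L)))
∈-selected g (here refl) gx rewrite gx = here refl
∈-selected g {y ∷ L} (there x∈) gx with g y
... | true = there (∈-selected g x∈ gx)
... | false = ∈-selected g x∈ gx

=ᶠ-refl : {n : ℕ} (x : Fin n) → (x =ᶠ x) ≡ true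
=ᶠ-refl x = dec-true (x Fin.≟ x) refl

edges-ordered : (H : Graph) → ∀ {ij} → ij ∈ edges H → Ordered ij
edges-ordered H {i , j} ij∈ =
  <ᵇ⇒< (toℕ i) (toℕ j) (Equivalence.from T-≡ (proj₂ (∈-filterᵇ⁻ _ allPairs ij∈orderedPairs)))
  where
  allPairs : List (Fin (v H) × Fin (v H))
  allPairs = cartesianProduct (allFin (v H)) (allFin (v H))
  ij∈orderedPairs : (i , j) ∈ orderedPairs (v H)
  ij∈orderedPairs = proj₁ (∈-filterᵇ⁻ _ (orderedPairs (v H)) ij∈)

edges-adjacent : (H : Graph) → ∀ {ij} → ij ∈ edges H → Graph.adj H (proj₁ ij) (proj₂ ij) ≡ true
edges-adjacent H ij∈ = proj₂ (∈-filterᵇ⁻ _ (orderedPairs (v H)) ij∈)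

edges-unique : (H : Graph) → Unique (edges H)
edges-unique H = Uniqueₚ.filter⁺ _ (orderedPairs-unique (v H))

module VertexMaps (H : Graph) (n : ℕ) where

  edgeImage : Vec (Fin n) (v H) → Fin (v H) × Fin (v H) → Fin n × Fin n
  edgeImage ψ (i , j) = sortPair (lookup ψ i) (lookup ψ j)

  image : Vec (Fin n) (v H) → List (Fin (v H) × Fin (v H)) → List (Fin n × Fin n)
  image ψ = map (edgeImage ψ)

  copyOf : Vec (Fin n) (v H) → List (Fin n × Fin n)
  copyOf ψ = fromChar (imageChar H n ψ)

  module Embedding (ψ : Vec (Fin n) (v H)) (inj : injectiveᵇ ψ ≡ true) where

    injective : ∀ {i j} → lookup ψ i ≡ lookup ψ j → i ≡ j
    injective {i} {j} ψi≡ψj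
      with all-true⁻ _ (allFin (v H)) (all-true⁻ _ (allFin (v H)) inj (∈-allFin i)) (∈-allFin j)
    ... | i=j∨ψi≠ψj with i Fin.≟ j
    ...   | yes i≡j = i≡j
    ...   | no _ rewrite ψi≡ψj | =ᶠ-refl (lookup ψ j) = case i=j∨ψi≠ψj of λ ()

    edgeImage-injective : ∀ {ij ij′} → Ordered ij → Ordered ij′ →
                          edgeImage ψ ij ≡ edgeImage ψ ij′ → ij ≡ ij′
    edgeImage-injective {i , j} {i′ , j′} i<j i′<j′ eq with sortPair-injective eq
    ... | inj₁ (ψi≡ψi′ , ψj≡ψj′) = cong₂ _,_ (injective ψi≡ψi′) (injective ψj≡ψj′)
    ... | inj₂ (ψi≡ψj′ , ψj≡ψi′) with injective {i} {j′} ψi≡ψj′ | injective {j} {i′} ψj≡ψi′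
    ...   | refl | refl = ⊥-elim (<-asym i<j i′<j′)

    image-unique : ∀ {E} → Unique E → All Ordered E → Unique (image ψ E)
    image-unique [] [] = []
    image-unique (ij∉ ∷ u) (ij< ∷ <s) =
      Allₚ.map⁺ (All.zipWith (λ (ij≢ , ij′<) eq → ij≢ (edgeImage-injective ij< ij′< eq)) (ij∉ , <s))
      ∷ image-unique u <s

    edgeImage∈KnEdges : ∀ {ij} → Ordered ij → edgeImage ψ ij ∈ KnEdges n
    edgeImage∈KnEdges {i , j} i<j =
      ∈-orderedPairs⁺ (sortPair-ordered (lookup ψ i) (lookup ψ j)
                                         (λ ψi≡ψj → <-irrefl (cong toℕ (injective ψi≡ψj)) i<j))

    edgeImage∈copyOf : ∀ {ij} → ij ∈ edges H → edgeImage ψ ij ∈ copyOf ψ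
    edgeImage∈copyOf {i , j} ij∈ = ∈-selected _ (edgeImage∈KnEdges (edges-ordered H ij∈))
                                               (preimage (sortPair-cases (lookup ψ i) (lookup ψ j)))
      where
      preimage : ∀ {xy} → xy ≡ (lookup ψ i , lookup ψ j) ⊎ xy ≡ (lookup ψ j , lookup ψ i) →
                 any (λ ij → Graph.adj H (proj₁ ij) (proj₂ ij)
                             ∧ (lookup ψ (proj₁ ij) =ᶠ proj₁ xy)
                             ∧ (lookup ψ (proj₂ ij) =ᶠ proj₂ xy))
                     (cartesianProduct (allFin (v H)) (allFin (v H))) ≡ true
      preimage (inj₁ refl) = any-true⁺ _ (∈-cartesianProduct⁺ (∈-allFin i) (∈-allFin j))
        (cong₂ _∧_ (edges-adjacent H ij∈)
                   (cong₂ _∧_ (=ᶠ-refl (lookup ψ i)) (=ᶠ-refl (lookup ψ j))))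
      preimage (inj₂ refl) = any-true⁺ _ (∈-cartesianProduct⁺ (∈-allFin j) (∈-allFin i))
        (cong₂ _∧_ (trans (Graph.sym H j i) (edges-adjacent H ij∈))
                   (cong₂ _∧_ (=ᶠ-refl (lookup ψ j)) (=ᶠ-refl (lookup ψ i))))

length-concatMap-const : (g : A → List B) (c : ℕ) (xs : List A) → (∀ x → length (g x) ≡ c) →
                         length (concatMap g xs) ≡ length xs * c
length-concatMap-const g c [] _ = refl
length-concatMap-const g c (x ∷ xs) |g|≡c =
  trans (length-++ (g x)) (cong₂ _+_ (|g|≡c x) (length-concatMap-const g c xs |g|≡c))

length-allFin : (n : ℕ) → length (allFin n) ≡ n
length-allFin n = length-tabulate id

length-allVecs : (as : List A) (k : ℕ) → length (allVecs as k) ≡ length as ^ k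
length-allVecs as zero = refl
length-allVecs as (suc k) =
  trans (length-concatMap-const _ _ as (λ x → length-map (x Vec.∷_) (allVecs as k)))
        (cong (length as *_) (length-allVecs as k))

module ClaimedCopies (H : Graph) (n b : ℕ) where
  open VertexMaps H n public
  open Weights (pairEq {n}) b public

  injectiveMaps : List (Vec (Fin n) (v H))
  injectiveMaps = filterᵇ injectiveᵇ (allVecs (allFin n) (v H))

  ∈-copies⁻ : ∀ {A} → A ∈ copies H n → ∃ λ ψ → ψ ∈ injectiveMaps × A ≡ copyOf ψ
  ∈-copies⁻ A∈ with ∈-map⁻ (fromChar {n}) A∈
  ... | c , c∈ , refl with ∈-map⁻ (imageChar H n) (∈-deduplicate⁻ (≡-dec Bool._≟_) _ c∈)
  ...   | ψ , ψ∈ , refl = ψ , ψ∈ , refl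

  length-claimed-copies : ∀ C → length (filterᵇ (λ A → claimed A C) (copies H n))
                                ≤ length (filterᵇ (λ ψ → claimed (copyOf ψ) C) injectiveMaps)
  length-claimed-copies C = begin
    length (filterᵇ (λ A → claimed A C) (copies H n))
      ≡⟨ length-filterᵇ-map _ (fromChar {n}) (deduplicate (≡-dec Bool._≟_) characteristics) ⟩
    length (filterᵇ (λ c → claimed (fromChar c) C) (deduplicate (≡-dec Bool._≟_) characteristics))
      ≤⟨ length-mono-≤ (filter⁺ _ _ (λ { refl p → p })
                                 (deduplicate-⊆ (≡-dec Bool._≟_) characteristics)) ⟩
    length (filterᵇ (λ c → claimed (fromChar c) C) characteristics)
      ≡⟨ length-filterᵇ-map _ (imageChar H n) injectiveMaps ⟩
    length (filterᵇ (λ ψ → claimed (copyOf ψ) C) injectiveMaps) ∎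
    where
    open ≤-Reasoning
    characteristics : List (List Bool)
    characteristics = map (imageChar H n) injectiveMaps

  claimedWeight-image : ∀ ψ → ψ ∈ injectiveMaps → ∀ {C} → claimed (copyOf ψ) C ≡ true →
                        ∀ {E} → Unique E → (∀ {ij} → ij ∈ E → ij ∈ edges H) →
                        suc b ^ length E ≤ claimedWeight (image ψ E) C
  claimedWeight-image ψ ψ∈ {C} copy-claimed {E} E-unique E⊆edges =
    subst (λ l → suc b ^ l ≤ claimedWeight (image ψ E) C) (length-map (edgeImage ψ) E)
      (claimedWeight-unique C (image-unique E-unique (All.tabulate (edges-ordered H ∘ E⊆edges)))
                            image-claimed)
    where
    open Embedding ψ (proj₂ (∈-filterᵇ⁻ injectiveᵇ (allVecs (allFin n) (v H)) ψ∈))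
    image-claimed : claimed (image ψ E) C ≡ true
    image-claimed = all-true⁺ _ (image ψ E) λ a∈ → case ∈-map⁻ (edgeImage ψ) a∈ of λ
      { (ij , ij∈ , refl) → all-true⁻ _ (copyOf ψ) copy-claimed (edgeImage∈copyOf (E⊆edges ij∈)) }

S*[1+b]^e≤n^v : (H : Graph) (n b : ℕ) → S H n b * suc b ^ e H ≤ n ^ v H
S*[1+b]^e≤n^v H n b = begin
  S H n b * suc b ^ e H
    ≤⟨ WCValue-*≤ (KnEdges n) (orderedPairs-unique n) (suc b ^ e H) claimed-bound ⟩
  length images                     ≡⟨ length-map _ injectiveMaps ⟩
  length injectiveMaps              ≤⟨ length-filter _ (allVecs (allFin n) (v H)) ⟩
  length (allVecs (allFin n) (v H)) ≡⟨ length-allVecs (allFin n) (v H) ⟩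
  length (allFin n) ^ v H           ≡⟨ cong (_^ v H) (length-allFin n) ⟩
  n ^ v H                           ∎
  where
  open ClaimedCopies H n b
  images : List (List (Fin n × Fin n))
  images = map (λ ψ → image ψ (edges H)) injectiveMaps
  open Potential (pairEq {n}) (copies H n) b images
  open ≤-Reasoning
  claimed-bound : ∀ C → score C * suc b ^ e H ≤ claimedPotential C
  claimed-bound C = begin
    score C * suc b ^ e H
      ≤⟨ *-monoˡ-≤ (suc b ^ e H) (length-claimed-copies C) ⟩
    length (filterᵇ (λ ψ → claimed (copyOf ψ) C) injectiveMaps) * suc b ^ e H
      ≤⟨ length-filterᵇ*≤∑ _ _ (suc b ^ e H) injectiveMaps
           (λ {ψ} ψ∈ copy-claimed → claimedWeight-image ψ ψ∈ {C} copy-claimed (edges-unique H) id) ⟩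
    ∑ (λ ψ → claimedWeight (image ψ (edges H)) C) injectiveMaps
      ≡⟨ sym (∑-map (λ A → claimedWeight A C) (λ ψ → image ψ (edges H)) injectiveMaps) ⟩
    claimedPotential C ∎

-- Sparse subgraphs

-- The n^|V| vertex maps sending every vertex outside V to z; they suffice to produce every copy of
-- a subgraph spanned by V.
module MapsOn {n : ℕ} (z : Fin n) where

  mapsOn : {k : ℕ} → Vec Bool k → List (Vec (Fin n) k)
  mapsOn [] = [] ∷ []
  mapsOn (true ∷ V) = concatMap (λ x → map (x ∷_) (mapsOn V)) (allFin n)
  mapsOn (false ∷ V) = map (z ∷_) (mapsOn V)

  restrict : {k : ℕ} → Vec Bool k → Vec (Fin n) k → Vec (Fin n) k
  restrict [] [] = []
  restrict (true ∷ V) (x ∷ ψ) = x ∷ restrict V ψ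
  restrict (false ∷ V) (x ∷ ψ) = z ∷ restrict V ψ

  length-mapsOn : {k : ℕ} (V : Vec Bool k) → length (mapsOn V) ≡ n ^ count (Vec.toList V)
  length-mapsOn [] = refl
  length-mapsOn (true ∷ V) =
    trans (length-concatMap-const _ _ (allFin n) (λ x → length-map (x ∷_) (mapsOn V)))
          (cong₂ _*_ (length-allFin n) (length-mapsOn V))
  length-mapsOn (false ∷ V) = trans (length-map (z ∷_) (mapsOn V)) (length-mapsOn V)

  restrict∈mapsOn : {k : ℕ} (V : Vec Bool k) (ψ : Vec (Fin n) k) → restrict V ψ ∈ mapsOn V
  restrict∈mapsOn [] [] = here refl
  restrict∈mapsOn (true ∷ V) (x ∷ ψ) = ∈-concatMap⁺ (λ y → map (y ∷_) (mapsOn V))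
    (lose (∈-allFin x) (∈-map⁺ (x ∷_) (restrict∈mapsOn V ψ)))
  restrict∈mapsOn (false ∷ V) (x ∷ ψ) = ∈-map⁺ (z ∷_) (restrict∈mapsOn V ψ)

  lookup-restrict : {k : ℕ} (V : Vec Bool k) (ψ : Vec (Fin n) k) (i : Fin k) →
                    lookup V i ≡ true → lookup (restrict V ψ) i ≡ lookup ψ i
  lookup-restrict (true ∷ V) (x ∷ ψ) fzero _ = refl
  lookup-restrict (true ∷ V) (x ∷ ψ) (fsuc i) Vi = lookup-restrict V ψ i Vi
  lookup-restrict (false ∷ V) (x ∷ ψ) (fsuc i) Vi = lookup-restrict V ψ i Vi

record Subgraph (H : Graph) : Set where
  field
    vertices : Vec Bool (v H)
    edgeList : List (Fin (v H) × Fin (v H))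
    unique   : Unique edgeList
    ⊆edges   : ∀ {ij} → ij ∈ edgeList → ij ∈ edges H
    spanned  : ∀ {ij} → ij ∈ edgeList →
               lookup vertices (proj₁ ij) ≡ true × lookup vertices (proj₂ ij) ≡ true

  order : ℕ
  order = count (Vec.toList vertices)

  size : ℕ
  size = length edgeList

wholeGraph : (H : Graph) → Subgraph H
wholeGraph H = record
  { vertices = Vec.replicate (v H) true
  ; edgeList = edges H
  ; unique   = edges-unique H
  ; ⊆edges   = id
  ; spanned  = λ {(i , j)} _ → Vecₚ.lookup-replicate i true , Vecₚ.lookup-replicate j true
  }

S≡0-of-sparse-subgraph : (H : Graph) (n b : ℕ) → 1 ≤ n → (H′ : Subgraph H) →
                         n ^ Subgraph.order H′ < suc b ^ Subgraph.size H′ → S H n b ≡ 0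
S≡0-of-sparse-subgraph H n@(suc _) b _ H′ sparse =
  WCValue≡0 (KnEdges n) (orderedPairs-unique n) (suc b ^ size) claimed-bound
            (subst (_< suc b ^ size) (sym |images|≡n^order) sparse)
  where
  open Subgraph H′
  open ClaimedCopies H n b
  open MapsOn {n} fzero
  images : List (List (Fin n × Fin n))
  images = map (λ ψ → image ψ edgeList) (mapsOn vertices)
  open Potential (pairEq {n}) (copies H n) b images

  |images|≡n^order : length images ≡ n ^ order
  |images|≡n^order = trans (length-map _ (mapsOn vertices)) (length-mapsOn vertices)

  image-restrict : ∀ ψ → image (restrict vertices ψ) edgeList ≡ image ψ edgeList
  image-restrict ψ = map-cong-local (All.tabulate λ {ij} ij∈ →
    cong₂ sortPair (lookup-restrict vertices ψ (proj₁ ij) (proj₁ (spanned ij∈)))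
                   (lookup-restrict vertices ψ (proj₂ ij) (proj₂ (spanned ij∈))))

  claimed-bound : ∀ C → 1 ≤ score C → suc b ^ size ≤ claimedPotential C
  claimed-bound C 1≤score
    with 1≤length⇒∈ {xs = filterᵇ (λ A → claimed A C) (copies H n)} 1≤score
  ... | A , A∈ with ∈-filterᵇ⁻ (λ A → claimed A C) (copies H n) A∈
  ...   | A∈copies , A-claimed with ∈-copies⁻ A∈copies
  ...     | ψ , ψ∈ , refl = begin
    suc b ^ size
      ≤⟨ claimedWeight-image ψ ψ∈ {C} A-claimed unique ⊆edges ⟩
    claimedWeight (image ψ edgeList) C
      ≡⟨ cong (λ A → claimedWeight A C) (sym (image-restrict ψ)) ⟩
    claimedWeight (image (restrict vertices ψ) edgeList) C
      ≤⟨ ∈⇒≤∑ (λ ψ → claimedWeight (image ψ edgeList) C) (restrict∈mapsOn vertices ψ) ⟩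
    ∑ (λ ψ → claimedWeight (image ψ edgeList) C) (mapsOn vertices)
      ≡⟨ sym (∑-map (λ A → claimedWeight A C) (λ ψ → image ψ edgeList) (mapsOn vertices)) ⟩
    claimedPotential C ∎
    where open ≤-Reasoning

-- Maximum density

maximum-or-0 : (ds : List ℚ) → foldr ℚ._⊔_ 0ℚ ds ≡ 0ℚ ⊎ foldr ℚ._⊔_ 0ℚ ds ∈ ds
maximum-or-0 [] = inj₁ refl
maximum-or-0 (d ∷ ds) with ℚₚ.⊔-sel d (foldr ℚ._⊔_ 0ℚ ds)
... | inj₁ max≡d = inj₂ (here max≡d)
... | inj₂ max≡rest with maximum-or-0 ds
...   | inj₁ rest≡0 = inj₁ (trans max≡rest rest≡0)
...   | inj₂ rest∈ = inj₂ (there (subst (_∈ ds) (sym max≡rest) rest∈))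

nonemptyVertexSets : (H : Graph) → List (Vec Bool (v H))
nonemptyVertexSets H = filterᵇ (λ V → 1 ≤ᵇ count (Vec.toList V)) (allVecs (true ∷ false ∷ []) (v H))

spannedEdges : (H : Graph) → Vec Bool (v H) → List (Fin (v H) × Fin (v H))
spannedEdges H V = filterᵇ (λ ij → lookup V (proj₁ ij) ∧ lookup V (proj₂ ij)) (edges H)

densest-subgraph : (H : Graph) → ∣ ↥ m H ∣ ≢ 0 →
                   Σ (Subgraph H) λ H′ → let open Subgraph H′ in
                     1 ≤ order × m H ≡ density size order
densest-subgraph H ∣↥m∣≢0 with maximum-or-0 (subgraphDensities H)
... | inj₁ m≡0 = ⊥-elim (∣↥m∣≢0 (cong (λ q → ∣ ↥ q ∣) m≡0))
... | inj₂ m∈ with find (∈-concatMap⁻ _ {xs = nonemptyVertexSets H} m∈)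
...   | V , V∈ , m∈V with ∈-map⁻ _ m∈V
...     | E , E∈ , m≡ = H′ , 1≤order , m≡
  where
  E⊆ : E ⊆ spannedEdges H V
  E⊆ = ∈-sublists⇒⊆ E∈
  H′ : Subgraph H
  H′ = record
    { vertices = V
    ; edgeList = E
    ; unique   = Unique-resp-⊇ E⊆ (Uniqueₚ.filter⁺ _ (edges-unique H))
    ; ⊆edges   = λ ij∈ → proj₁ (∈-filterᵇ⁻ _ (edges H) (Any-resp-⊆ E⊆ ij∈))
    ; spanned  = λ ij∈ → ∧-true⁻ (proj₂ (∈-filterᵇ⁻ _ (edges H) (Any-resp-⊆ E⊆ ij∈)))
    }
  1≤order : 1 ≤ count (Vec.toList V)
  1≤order = ≤ᵇ⇒≤ 1 _ (Equivalence.from T-≡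
    (proj₂ (∈-filterᵇ⁻ _ (allVecs (true ∷ false ∷ []) (v H)) V∈)))

density-cross : (e′ v′ : ℕ) → 1 ≤ v′ → e′ * ↧ₙ density e′ v′ ≡ ∣ ↥ density e′ v′ ∣ * v′
density-cross e′ v′@(suc _) _ = begin
  e′ * ↧ₙ q             ≡⟨ cong (_* ↧ₙ q) (sym num*d≡e′) ⟩
  ∣ ↥ q ∣ * d * ↧ₙ q    ≡⟨ *-assoc ∣ ↥ q ∣ d (↧ₙ q) ⟩
  ∣ ↥ q ∣ * (d * ↧ₙ q)  ≡⟨ cong (∣ ↥ q ∣ *_) (*-comm d (↧ₙ q)) ⟩
  ∣ ↥ q ∣ * (↧ₙ q * d)  ≡⟨ cong (∣ ↥ q ∣ *_) den*d≡v′ ⟩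
  ∣ ↥ q ∣ * v′          ∎
  where
  open ≡-Reasoning
  q : ℚ
  q = density e′ v′
  d : ℕ
  d = ∣ ℤ.gcd (+ℤ e′) (+ℤ v′) ∣
  num*d≡e′ : ∣ ↥ q ∣ * d ≡ e′
  num*d≡e′ = trans (sym (ℤₚ.abs-* (↥ q) (ℤ.gcd (+ℤ e′) (+ℤ v′)))) (cong ∣_∣ (ℚₚ.↥-/ (+ℤ e′) v′))
  den*d≡v′ : ↧ₙ q * d ≡ v′
  den*d≡v′ = trans (sym (ℤₚ.abs-* (↧ q) (ℤ.gcd (+ℤ e′) (+ℤ v′)))) (cong ∣_∣ (ℚₚ.↧-/ (+ℤ e′) v′))

n≤n^k : ∀ {n} k → 1 ≤ n → 1 ≤ k → n ≤ n ^ k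
n≤n^k {n} (suc k) 1≤n _ = subst (_≤ n ^ suc k) (*-identityʳ n)
  (*-monoʳ-≤ n (subst (_≤ n ^ k) (^-zeroˡ k) (^-monoˡ-≤ k 1≤n)))

-- With p / q = e′ / v′, the hypothesis n ^ q ≤ b ^ p says b ≥ n ^ (v′ / e′).
^-<-of-ratio : (n b e′ v′ p q : ℕ) → n ^ q ≤ b ^ p → e′ * q ≡ p * v′ → 1 ≤ p * v′ →
               n ^ v′ < suc b ^ e′
^-<-of-ratio n b e′ v′ p q n^q≤b^p e′q≡pv′ 1≤pv′ = ≰⇒> λ [1+b]^e′≤n^v′ →
  <⇒≱ b^N<[1+b]^N (begin
    suc b ^ (e′ * q)  ≡⟨ sym (^-*-assoc (suc b) e′ q) ⟩
    (suc b ^ e′) ^ q  ≤⟨ ^-monoˡ-≤ q [1+b]^e′≤n^v′ ⟩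
    (n ^ v′) ^ q      ≡⟨ ^-*-assoc n v′ q ⟩
    n ^ (v′ * q)      ≡⟨ cong (n ^_) (*-comm v′ q) ⟩
    n ^ (q * v′)      ≡⟨ sym (^-*-assoc n q v′) ⟩
    (n ^ q) ^ v′      ≤⟨ ^-monoˡ-≤ v′ n^q≤b^p ⟩
    (b ^ p) ^ v′      ≡⟨ ^-*-assoc b p v′ ⟩
    b ^ (p * v′)      ≡⟨ cong (b ^_) (sym e′q≡pv′) ⟩
    b ^ (e′ * q)      ∎)
  where
  open ≤-Reasoning
  b^N<[1+b]^N : b ^ (e′ * q) < suc b ^ (e′ * q)
  b^N<[1+b]^N = ^-monoˡ-< (e′ * q) {{>-nonZero (subst (1 ≤_) (sym e′q≡pv′) 1≤pv′)}} (n<1+n b)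

n^den≤b^num⇒S≡0 : (H : Graph) → 1 ≤ e H → (n b : ℕ) → 1 ≤ n → 1 ≤ b →
                  n ^ ↧ₙ m H ≤ b ^ ∣ ↥ m H ∣ → S H n b ≡ 0
n^den≤b^num⇒S≡0 H 1≤e n b 1≤n 1≤b n^den≤b^num with ∣ ↥ m H ∣ ≟ 0
-- m H > 0 as e H ≥ 1, but it is cheaper to observe that a zero numerator forces n = 1.
... | yes num≡0 = subst (λ n → S H n b ≡ 0) (sym n≡1)
  (S≡0-of-sparse-subgraph H 1 b ≤-refl (wholeGraph H)
    (subst (_< suc b ^ e H) (sym (^-zeroˡ (Subgraph.order (wholeGraph H))))
           (≤-trans (s≤s 1≤b) (n≤n^k (e H) (s≤s z≤n) 1≤e))))
  where
  n≡1 : n ≡ 1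
  n≡1 = ≤-antisym (≤-trans (n≤n^k (↧ₙ m H) 1≤n (s≤s z≤n))
                           (subst (λ p → n ^ ↧ₙ m H ≤ b ^ p) num≡0 n^den≤b^num)) 1≤n
... | no num≢0 with densest-subgraph H num≢0
...   | H′ , 1≤order , m≡ = S≡0-of-sparse-subgraph H n b 1≤n H′
  (^-<-of-ratio n b size order ∣ ↥ m H ∣ (↧ₙ m H) n^den≤b^num
     (subst (λ q → size * ↧ₙ q ≡ ∣ ↥ q ∣ * order) (sym m≡) (density-cross size order 1≤order))
     (*-mono-≤ (n≢0⇒n>0 num≢0) 1≤order))
  where open Subgraph H′

theorem1p3 : (H : Graph) → 1 ≤ e H →
  Σ ℕ λ c → Σ ℕ λ c′ → (1 ≤ c) × (1 ≤ c′) ×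
    ((n b : ℕ) → 1 ≤ n → 1 ≤ b → S H n b * (suc b) ^ e H ≤ c * n ^ v H) ×
    ((n b : ℕ) → 1 ≤ n → 1 ≤ b →
       c′ * n ^ (↧ₙ m H) ≤ b ^ ∣ ↥ m H ∣ → S H n b ≡ 0)
theorem1p3 H 1≤e =
  1 , 1 , ≤-refl , ≤-refl ,
  (λ n b _ _ → ≤-trans (S*[1+b]^e≤n^v H n b) (≤-reflexive (sym (*-identityˡ (n ^ v H))))) ,
  (λ n b 1≤n 1≤b hyp →
     n^den≤b^num⇒S≡0 H 1≤e n b 1≤n 1≤b (≤-trans (≤-reflexive (sym (*-identityˡ _))) hyp))
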